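{- Let $n\ge 1$, let $A=(a_{ij})_{i,j=1}^n$ be a symmetric matrix over $\mathbb{F}_2$, and let $D=M_A$ be its nondegeneracy delta-matroid on ground set $E=\{1,\dots,n\}$. Let $A'$ be the symmetric $(n+1)\times(n+1)$ matrix over $\mathbb{F}_2$ obtained from $A$ by adding an $(n+1)$-st row and column with $a_{1,n+1}=a_{n+1,1}=1$ and $a_{i,n+1}=a_{n+1,i}=0$ for all $2\le i\le n+1$, and let $D'=M_{A'}$. Then $$q_{\Delta}(D',x)=q_{\Delta}(D,x)+(x+1)\,q_{\Delta}(D\setminus 1,x).$$
   Context: For a symmetric matrix $A$ over $\mathbb{F}_2$ with rows/columns indexed by a finite set $E$, the nondegeneracy delta-matroid is $M_A=(E,\Phi)$ with $X\in\Phi$ iff the principal submatrix $A[X]$ is nondegenerate over $\mathbb{F}_2$ (the empty matrix counts as nondegenerate). For a delta-matroid $D=(E,\Phi)$ and $e\in E$: $e$ is a coloop if it lies in every feasible set; if $e$ is not a coloop, $D\setminus e=(E\setminus\{e\},\{F\in\Phi: e\notin F\})$; if $e$ is a coloop, $D\setminus e=D/e=(E\setminus\{e\},\{F\setminus\{e\}:F\in\Phi\})$. The distance is $d_D(X)=\min_{F\in\Phi}|F\Delta X|$ and the interlace polynomial is $q_{\Delta}(D,x)=\sum_{\phi\subseteq E}x^{d_D(\phi)}$. -}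

module Defs where

open import Data.Nat using (ℕ; zero; suc; _+_; _⊔_; _⊓_)
open import Data.Bool using (Bool; true; false; _∧_; _∨_; _xor_; not; if_then_else_)
open import Data.Fin using (Fin; zero; suc; fromℕ; toℕ)
open import Data.Vec using (Vec; []; _∷_; lookup; zipWith; replicate)
open import Data.List using (List; []; _∷_; map; _++_; foldr; filter; length)
open import Data.Fin.Subset using (Subset; ∣_∣; ⊥)
open import Relation.Binary.PropositionalEquality using (_≡_)
open import Data.Vec.Properties using (≡-dec)
open import Data.Bool.Properties using () renaming (_≟_ to _≟B_)
open import Data.Nat.Properties using (_≟_)
open import Data.Maybe using (Maybe; just; nothing)
import Data.Maybe
open import Relation.Nullary.Decidable using (⌊_⌋)

allL : ∀ {A : Set} → (A → Bool) → List A → Bool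
allL p = foldr (λ x b → p x ∧ b) true

-- Matrices over F₂ = Bool (true = 1, _xor_ = +, _∧_ = ·), indexed by Fin n.
Matrix : ℕ → Set
Matrix n = Fin n → Fin n → Bool

Symmetric : ∀ {n} → Matrix n → Set
Symmetric {n} A = ∀ (i j : Fin n) → A i j ≡ A j i

allSubsets : ∀ k → List (Subset k)
allSubsets zero    = [] ∷ []
allSubsets (suc k) = map (false ∷_) (allSubsets k) ++ map (true ∷_) (allSubsets k)

allFin : ∀ k → (Fin k → Bool) → Bool
allFin zero    p = true
allFin (suc k) p = p zero ∧ allFin k (λ i → p (suc i))

sumF2 : ∀ k → (Fin k → Bool) → Bool
sumF2 zero    f = false
sumF2 (suc k) f = f zero xor sumF2 k (λ i → f (suc i))

_⇒b_ : Bool → Bool → Bool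
a ⇒b b = not a ∨ b

subsetB : ∀ {k} → Subset k → Subset k → Bool
subsetB {k} v X = allFin k (λ i → lookup v i ⇒b lookup X i)

-- The principal submatrix A[X] is nondegenerate over F₂: the only vector v
-- supported on X with (A v)_i = 0 for all i ∈ X is v = 0
-- (i.e. A[X] has trivial kernel over F₂).  The empty matrix is nondegenerate.
nondegB : ∀ {k} → Matrix k → Subset k → Bool
nondegB {k} A X =
  allL (λ v → (subsetB v X ∧
              allFin k (λ i → lookup X i ⇒b not (sumF2 k (λ j → A i j ∧ lookup v j))))
             ⇒b ⌊ ≡-dec _≟B_ v ⊥ ⌋)
      (allSubsets k)

DeltaMatroid : ℕ → Set
DeltaMatroid k = Subset k → Bool

M : ∀ {k} → Matrix k → DeltaMatroid k
M A X = nondegB A X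

-- The first element (element "1") of the ground set is zero : Fin (suc k).
isColoop₁ : ∀ {k} → DeltaMatroid (suc k) → Bool
isColoop₁ {k} D = allL (λ F → D F ⇒b lookup F zero) (allSubsets (suc k))

delete₁ : ∀ {k} → DeltaMatroid (suc k) → DeltaMatroid k
delete₁ D Y = if isColoop₁ D then D (true ∷ Y) else D (false ∷ Y)

symDiff : ∀ {k} → Subset k → Subset k → Subset k
symDiff = zipWith _xor_

-- d_D(X) = min over feasible F of |F Δ X|.  (Starting value k is an upper bound
-- for every |F Δ X|, so it only matters when Φ = ∅, which never happens here.)
dist : ∀ {k} → DeltaMatroid k → Subset k → ℕ
dist {k} D X = foldr (λ F m → if D F then ∣ symDiff F X ∣ ⊓ m else m) k (allSubsets k)

-- Polynomials with ℕ coefficients, as coefficient sequences (coefficient of x^i).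
Poly : Set
Poly = ℕ → ℕ

_+ₚ_ : Poly → Poly → Poly
(p +ₚ q) i = p i + q i

x+1*_ : Poly → Poly
(x+1* p) zero    = p zero
(x+1* p) (suc i) = p (suc i) + p i

qΔ : ∀ {k} → DeltaMatroid k → Poly
qΔ {k} D i = length (filter (λ φ → dist D φ ≟ i) (allSubsets k))

-- A' : add an (n+1)-st row/column (index fromℕ n = last) with a_{1,n+1} = a_{n+1,1} = 1
-- and all other new entries 0 (including a_{n+1,n+1}).
-- Index view on Fin (suc m): the last index (fromℕ m) ↦ nothing, inject₁ i ↦ just i.
oldIndex : ∀ {m} → Fin (suc m) → Maybe (Fin m)
oldIndex {zero}  zero    = nothing
oldIndex {suc m} zero    = just zero
oldIndex {suc m} (suc i) = Data.Maybe.map suc (oldIndex i)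

isFirst : ∀ {m} → Fin m → Bool
isFirst zero    = true
isFirst (suc _) = false

extendEntry : ∀ {n} → Matrix n → Maybe (Fin n) → Maybe (Fin n) → Bool
extendEntry A (just a) (just b) = A a b
extendEntry A (just a) nothing  = isFirst a
extendEntry A nothing  (just b) = isFirst b
extendEntry A nothing  nothing  = false

extend : ∀ {n} → Matrix n → Matrix (suc n)
extend A i j = extendEntry A (oldIndex i) (oldIndex j)

-- Write 1 for the first and n+1 for the new element (the last coordinate, reached with _∷ʳ_).
-- As n+1 is coupled to 1 alone, the feasible sets of D′ are the feasible sets F of D and the
-- sets Y ∪ {1, n+1} with Y feasible in D ∖ 1 (1 is never a coloop since ∅ is feasible); a
-- set containing n+1 but not 1 is degenerate, e_{n+1} being in its kernel. Hence
--   d_{D′}(X) = d_D(X)                      if n+1 ∉ X,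
--   d_{D′}(X) = 1 + d_{D∖1}(X ∖ {n+1})      if n+1 ∈ X, 1 ∉ X,
--   d_{D′}(X) = d_{D∖1}(X ∖ {1, n+1})       if 1, n+1 ∈ X,
-- and summing x^{d_{D′}(X)} over the three classes gives q(D) + x q(D∖1) + q(D∖1).
-- The lower bounds need an exchange property of M_A: every feasible F is within one step of a
-- feasible set avoiding 1. If 1 ∈ F and A[F ∖ 1] is degenerate with kernel vector v, then
-- A[F ∖ {1, u}] is nondegenerate for every u in the support of v, by the symmetry of A.

module Submission where

open import Defs
open import Algebra.Bundles using (CommutativeRing)
open import Data.Bool using (Bool; true; false; _∧_; _xor_; not; if_then_else_)
open import Data.Bool.Properties
  using (xor-∧-commutativeRing; not-injective; ∧-zeroʳ; ∧-identityʳ; xor-identityʳ; xor-same; ⇔→≡)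
  renaming (_≟_ to _≟ᵇ_)
open import Data.Bool.Solver using (module xor-∧-Solver)
open import Data.Empty using (⊥-elim)
open import Data.Fin using (Fin; zero; suc; inject₁; fromℕ; punchIn) renaming (_≟_ to _≟ᶠ_)
open import Data.Fin.Properties using (punchInᵢ≢i)
open import Data.Fin.Subset using (Subset; ⊥; ∣_∣)
open import Data.Fin.Subset.Properties using (∣p∣≤n)
open import Data.List using (List; []; _∷_; map; foldr; filter; length)
open import Data.List.Properties using (filter-++; length-++; filter-≐; filter-none)
open import Data.List.Membership.Propositional using (_∈_)
open import Data.List.Membership.Propositional.Properties using (∈-map⁺; ∈-++⁺ˡ; ∈-++⁺ʳ)
open import Data.List.Relation.Unary.All as All using (All; []; _∷_)
open import Data.List.Relation.Unary.Any as Any using (Any; here; there)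
open import Data.Maybe using (just; nothing)
import Data.Maybe as Maybe
open import Data.Nat using (ℕ; zero; suc; _+_; _≤_; _⊓_; s≤s)
open import Data.Nat.Properties
  using (_≟_; suc-injective; +-comm; +-commutativeSemigroup; ≤-refl; ≤-reflexive; ≤-trans; ≤-antisym;
         n≤1+n; m≤n⇒m≤1+n; m⊓n≤m; m⊓n≤n; ⊓-sel; +-monoʳ-≤)
open import Data.Product using (∃-syntax; _×_; _,_; proj₁; proj₂)
open import Data.Sum using (_⊎_; inj₁; inj₂)
open import Data.Vec using (Vec; []; _∷_; lookup; zipWith; _[_]≔_; _∷ʳ_; initLast)
open import Data.Vec.Properties
  using (≡-dec; lookup-replicate; lookup-zipWith; lookup∘update; lookup∘update′; ∷ʳ-injective)
open import Function using (_∘_; id; _⇔_; mk⇔; Equivalence; case_of_)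
open import Relation.Binary.PropositionalEquality
open import Relation.Nullary using (¬_; Dec; yes; no; does)
open import Relation.Nullary.Decidable using (isYes; isYes≗does; dec-true)
open import Relation.Unary using (Pred; Decidable)

open import Algebra.Properties.CommutativeSemigroup +-commutativeSemigroup using (interchange)
open import Algebra.Properties.Semiring.Sum (CommutativeRing.semiring xor-∧-commutativeRing)

open Equivalence using (to; from)
open ≡-Reasoning

∧-true⁻ : ∀ {a b} → a ∧ b ≡ true → a ≡ true × b ≡ true
∧-true⁻ {true} b≡true = refl , b≡true

⇒b-true⁻ : ∀ {a b} → a ⇒b b ≡ true → a ≡ true → b ≡ true
⇒b-true⁻ {true} b≡true refl = b≡true

⇒b-true⁺ : ∀ a {b} → (a ≡ true → b ≡ true) → a ⇒b b ≡ true
⇒b-true⁺ false _ = refl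
⇒b-true⁺ true  f = f refl

⇒b-false⁻ : ∀ {a b} → a ⇒b b ≡ false → a ≡ true × b ≡ false
⇒b-false⁻ {false} ()
⇒b-false⁻ {true} {false} _ = refl , refl

xor-∧-true⁻ : ∀ {a b c} → a xor (b ∧ c) ≡ true → a ≡ true ⊎ c ≡ true
xor-∧-true⁻ {true}  _ = inj₁ refl
xor-∧-true⁻ {false} e = inj₂ (proj₂ (∧-true⁻ e))

xor-∧-false : ∀ a b → a xor (b ∧ false) ≡ a
xor-∧-false a b = trans (cong (a xor_) (∧-zeroʳ b)) (xor-identityʳ a)

isYes-true⁻ : ∀ {P : Set} (P? : Dec P) → isYes P? ≡ true → P
isYes-true⁻ (yes p) _ = p

isYes-true⁺ : ∀ {P : Set} (P? : Dec P) → P → isYes P? ≡ true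
isYes-true⁺ P? p = trans (isYes≗does P?) (dec-true P? p)

isYes-false⁻ : ∀ {P : Set} (P? : Dec P) → isYes P? ≡ false → ¬ P
isYes-false⁻ (no ¬p) _ = ¬p

allL⁻ : ∀ {A : Set} {p : A → Bool} xs → allL p xs ≡ true → All (λ x → p x ≡ true) xs
allL⁻ []       _ = []
allL⁻ (x ∷ xs) e = proj₁ (∧-true⁻ e) ∷ allL⁻ xs (proj₂ (∧-true⁻ e))

allL⁺ : ∀ {A : Set} {p : A → Bool} {xs} → All (λ x → p x ≡ true) xs → allL p xs ≡ true
allL⁺ []         = refl
allL⁺ (px ∷ pxs) = cong₂ _∧_ px (allL⁺ pxs)

allL-false⁻ : ∀ {A : Set} {p : A → Bool} xs → allL p xs ≡ false → Any (λ x → p x ≡ false) xs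
allL-false⁻ {p = p} (x ∷ xs) e with p x in px
... | false = here px
... | true  = there (allL-false⁻ xs e)

allFin⁻ : ∀ k {p : Fin k → Bool} → allFin k p ≡ true → ∀ i → p i ≡ true
allFin⁻ (suc k) e zero    = proj₁ (∧-true⁻ e)
allFin⁻ (suc k) e (suc i) = allFin⁻ k (proj₂ (∧-true⁻ e)) i

allFin⁺ : ∀ k {p : Fin k → Bool} → (∀ i → p i ≡ true) → allFin k p ≡ true
allFin⁺ zero    _ = refl
allFin⁺ (suc k) f = cong₂ _∧_ (f zero) (allFin⁺ k (f ∘ suc))

∈-allSubsets : ∀ {k} (v : Subset k) → v ∈ allSubsets k
∈-allSubsets []          = here refl
∈-allSubsets (false ∷ v) = ∈-++⁺ˡ (∈-map⁺ (false ∷_) (∈-allSubsets v))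
∈-allSubsets (true ∷ v)  = ∈-++⁺ʳ (map (false ∷_) (allSubsets _)) (∈-map⁺ (true ∷_) (∈-allSubsets v))

allSubsets⁻ : ∀ {k} {p : Subset k → Bool} → allL p (allSubsets k) ≡ true → ∀ v → p v ≡ true
allSubsets⁻ e v = All.lookup (allL⁻ _ e) (∈-allSubsets v)

allSubsets⁺ : ∀ {k} {p : Subset k → Bool} → (∀ v → p v ≡ true) → allL p (allSubsets k) ≡ true
allSubsets⁺ {k} f = allL⁺ {xs = allSubsets k} (All.tabulate (λ {v} _ → f v))

≡⊥⁺ : ∀ {k} (v : Subset k) → (∀ i → lookup v i ≡ false) → v ≡ ⊥
≡⊥⁺ []      _ = refl
≡⊥⁺ (x ∷ v) f = cong₂ _∷_ (f zero) (≡⊥⁺ v (f ∘ suc))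

lookup-⊥ : ∀ {k} (i : Fin k) → lookup ⊥ i ≡ false
lookup-⊥ i = lookup-replicate i false

≢⊥⇒∃ : ∀ {k} (v : Subset k) → v ≢ ⊥ → ∃[ u ] lookup v u ≡ true
≢⊥⇒∃ []          v≢⊥ = ⊥-elim (v≢⊥ refl)
≢⊥⇒∃ (true ∷ v)  _   = zero , refl
≢⊥⇒∃ (false ∷ v) v≢⊥ with ≢⊥⇒∃ v (v≢⊥ ∘ cong (false ∷_))
... | u , vᵤ = suc u , vᵤ

lookup-true⇒≢⊥ : ∀ {k} {v : Subset k} {u} → lookup v u ≡ true → v ≢ ⊥
lookup-true⇒≢⊥ {u = u} vᵤ refl = case trans (sym vᵤ) (lookup-⊥ u) of λ ()

_⊆_ : ∀ {k} → Subset k → Subset k → Set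
v ⊆ X = ∀ i → lookup v i ≡ true → lookup X i ≡ true

⊆-false : ∀ {k} (v X : Subset k) → v ⊆ X → ∀ {i} → lookup X i ≡ false → lookup v i ≡ false
⊆-false v X v⊆X {i} Xᵢ with lookup v i in vᵢ
... | false = refl
... | true  = case trans (sym (v⊆X i vᵢ)) Xᵢ of λ ()

update-⊆ : ∀ {k} (X : Subset k) u → (X [ u ]≔ false) ⊆ X
update-⊆ X u i e with i ≟ᶠ u
... | yes refl = case trans (sym (lookup∘update u X false)) e of λ ()
... | no i≢u   = trans (sym (lookup∘update′ i≢u X false)) e

∈-update : ∀ {k} (X : Subset k) {i u} → i ≢ u → lookup X i ≡ true → lookup (X [ u ]≔ false) i ≡ true
∈-update X i≢u i∈X = trans (lookup∘update′ i≢u X false) i∈X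

-- Nondegeneracy of principal submatrices over F₂

_*ᵥ_ : ∀ {k} → Matrix k → Subset k → Fin k → Bool
(A *ᵥ v) i = sum (λ j → A i j ∧ lookup v j)

InKernel : ∀ {k} → Matrix k → Subset k → Subset k → Set
InKernel A X v = ∀ i → lookup X i ≡ true → (A *ᵥ v) i ≡ false

Nondeg : ∀ {k} → Matrix k → Subset k → Set
Nondeg A X = ∀ v → v ⊆ X → InKernel A X v → v ≡ ⊥

-- sumF2 is the sum of the Boolean ring (xor, ∧); rewriting it as such gives the library's summation lemmas.
sumF2≡sum : ∀ k (f : Fin k → Bool) → sumF2 k f ≡ sum f
sumF2≡sum zero    f = refl
sumF2≡sum (suc k) f = cong (f zero xor_) (sumF2≡sum k (f ∘ suc))

subsetB⇔ : ∀ {k} (v X : Subset k) → subsetB v X ≡ true ⇔ v ⊆ X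
subsetB⇔ {k} v X = mk⇔ (λ e i → ⇒b-true⁻ (allFin⁻ k e i)) (λ v⊆X → allFin⁺ k (λ i → ⇒b-true⁺ _ (v⊆X i)))

inKernelB : ∀ {k} → Matrix k → Subset k → Subset k → Bool
inKernelB {k} A X v = allFin k (λ i → lookup X i ⇒b not (sumF2 k (λ j → A i j ∧ lookup v j)))

inKernelB⇔ : ∀ {k} (A : Matrix k) (X v : Subset k) → inKernelB A X v ≡ true ⇔ InKernel A X v
inKernelB⇔ {k} A X v = mk⇔
  (λ e i i∈X → trans (sym (sumF2≡sum k _)) (not-injective (⇒b-true⁻ (allFin⁻ k e i) i∈X)))
  (λ ker → allFin⁺ k (λ i → ⇒b-true⁺ _ (λ i∈X → cong not (trans (sumF2≡sum k _) (ker i i∈X)))))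

module _ {k} (A : Matrix k) (X : Subset k) where

  nondegB⇔ : nondegB A X ≡ true ⇔ Nondeg A X
  nondegB⇔ = mk⇔
    (λ e v v⊆X ker → isYes-true⁻ (≡-dec _≟ᵇ_ v ⊥)
       (⇒b-true⁻ (allSubsets⁻ e v) (cong₂ _∧_ (from (subsetB⇔ v X) v⊆X) (from (inKernelB⇔ A X v) ker))))
    (λ nd → allSubsets⁺ (λ v → ⇒b-true⁺ _ (λ e →
       let (v⊆X , ker) = ∧-true⁻ e
       in isYes-true⁺ (≡-dec _≟ᵇ_ v ⊥) (nd v (to (subsetB⇔ v X) v⊆X) (to (inKernelB⇔ A X v) ker)))))

  nondegB-false⁻ : nondegB A X ≡ false → ∃[ v ] v ⊆ X × InKernel A X v × v ≢ ⊥
  nondegB-false⁻ e with Any.satisfied (allL-false⁻ (allSubsets k) e)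
  ... | v , bad with ⇒b-false⁻ bad
  ... | conds , v≢⊥ with ∧-true⁻ conds
  ... | v⊆X , ker = v , to (subsetB⇔ v X) v⊆X , to (inKernelB⇔ A X v) ker , isYes-false⁻ (≡-dec _≟ᵇ_ v ⊥) v≢⊥

M-cong : ∀ {k l} {A : Matrix k} {B : Matrix l} {X Y} → Nondeg A X ⇔ Nondeg B Y → M A X ≡ M B Y
M-cong {A = A} {B} {X} {Y} A⇔B = ⇔→≡ (mk⇔
  (from (nondegB⇔ B Y) ∘ to A⇔B ∘ to (nondegB⇔ A X))
  (from (nondegB⇔ A X) ∘ from A⇔B ∘ to (nondegB⇔ B Y)))

M-false : ∀ {k} {A : Matrix k} {X} → ¬ Nondeg A X → M A X ≡ false
M-false {A = A} {X} ¬nd with M A X in e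
... | false = refl
... | true  = ⊥-elim (¬nd (to (nondegB⇔ A X) e))

M-⊥ : ∀ {k} (A : Matrix k) → M A ⊥ ≡ true
M-⊥ A = from (nondegB⇔ A ⊥) λ v v⊆⊥ _ → ≡⊥⁺ v (λ i → ⊆-false v ⊥ v⊆⊥ (lookup-⊥ i))

sum-zero : ∀ {k} {f : Fin k → Bool} → (∀ i → f i ≡ false) → sum f ≡ false
sum-zero {k} f≡false = trans (sum-cong-≗ f≡false) (sum-replicate-zero k)

sum-single : ∀ {k} (f : Fin k → Bool) u → (∀ i → i ≢ u → f i ≡ false) → sum f ≡ f u
sum-single {suc _} f u f≡false = begin
  sum f                               ≡⟨ sum-remove f ⟩
  f u xor sum (f ∘ punchIn u)          ≡⟨ cong (f u xor_) (sum-zero (λ j → f≡false _ (punchInᵢ≢i u j))) ⟩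
  f u xor false                        ≡⟨ xor-identityʳ (f u) ⟩
  f u                                  ∎

*ᵥ-⊥ : ∀ {k} (A : Matrix k) i → (A *ᵥ ⊥) i ≡ false
*ᵥ-⊥ A i = sum-zero (λ j → trans (cong (A i j ∧_) (lookup-⊥ j)) (∧-zeroʳ (A i j)))

*ᵥ-xor-scaled : ∀ {k} (A : Matrix k) (w v : Subset k) α i →
  (A *ᵥ zipWith (λ a b → a xor (α ∧ b)) w v) i ≡ (A *ᵥ w) i xor (α ∧ (A *ᵥ v) i)
*ᵥ-xor-scaled {k} A w v α i = begin
  sum (λ j → A i j ∧ lookup (zipWith (λ a b → a xor (α ∧ b)) w v) j)
    ≡⟨ sum-cong-≗ (λ j → trans (cong (A i j ∧_) (lookup-zipWith _ j w v))
                              (distrib (A i j) (lookup w j) α (lookup v j))) ⟩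
  sum (λ j → (A i j ∧ lookup w j) xor (α ∧ (A i j ∧ lookup v j)))
    ≡⟨ ∑-distrib-+ {k} _ _ ⟩
  (A *ᵥ w) i xor sum (λ j → α ∧ (A i j ∧ lookup v j))
    ≡⟨ cong ((A *ᵥ w) i xor_) (*-distribˡ-sum {k} α _) ⟨
  (A *ᵥ w) i xor (α ∧ (A *ᵥ v) i)   ∎
  where
  open xor-∧-Solver
  distrib : ∀ a x b y → a ∧ (x xor (b ∧ y)) ≡ (a ∧ x) xor (b ∧ (a ∧ y))
  distrib = solve 4 (λ a x b y → a :* (x :+ (b :* y)) := (a :* x) :+ (b :* (a :* y))) refl

*ᵥ-transpose : ∀ {k} {A : Matrix k} → Symmetric A → ∀ v w →
  sum (λ i → lookup v i ∧ (A *ᵥ w) i) ≡ sum (λ j → lookup w j ∧ (A *ᵥ v) j)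
*ᵥ-transpose {k} {A} symA v w = begin
  sum (λ i → lookup v i ∧ (A *ᵥ w) i)
    ≡⟨ sum-cong-≗ (λ i → *-distribˡ-sum {k} (lookup v i) _) ⟩
  sum (λ i → sum (λ j → lookup v i ∧ (A i j ∧ lookup w j)))
    ≡⟨ ∑-comm {k} {k} _ ⟩
  sum (λ j → sum (λ i → lookup v i ∧ (A i j ∧ lookup w j)))
    ≡⟨ sum-cong-≗ (λ j → sum-cong-≗ (λ i →
         trans (swap (lookup v i) (A i j) (lookup w j)) (cong (λ a → lookup w j ∧ (a ∧ lookup v i)) (symA i j)))) ⟩
  sum (λ j → sum (λ i → lookup w j ∧ (A j i ∧ lookup v i)))
    ≡⟨ sum-cong-≗ (λ j → *-distribˡ-sum {k} (lookup w j) _) ⟨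
  sum (λ j → lookup w j ∧ (A *ᵥ v) j)   ∎
  where
  open xor-∧-Solver
  swap : ∀ x a y → x ∧ (a ∧ y) ≡ y ∧ (a ∧ x)
  swap = solve 3 (λ x a y → x :* (a :* y) := y :* (a :* x)) refl

sum-∧-InKernel : ∀ {k} {A : Matrix k} {X v w : Subset k} →
  InKernel A X v → w ⊆ X → sum (λ j → lookup w j ∧ (A *ᵥ v) j) ≡ false
sum-∧-InKernel {A = A} {v = v} {w} ker w⊆X = sum-zero term
  where
  term : ∀ j → lookup w j ∧ (A *ᵥ v) j ≡ false
  term j with lookup w j in wⱼ
  ... | false = refl
  ... | true  = ker j (w⊆X j wⱼ)

∣∷∣-≤-suc : ∀ {k} a b (p : Subset k) → ∣ a ∷ p ∣ ≤ suc ∣ b ∷ p ∣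
∣∷∣-≤-suc false false p = n≤1+n _
∣∷∣-≤-suc false true  p = m≤n⇒m≤1+n (n≤1+n _)
∣∷∣-≤-suc true  false p = ≤-refl
∣∷∣-≤-suc true  true  p = s≤s (n≤1+n _)

∣symDiff-flipˡ∣ : ∀ {k} a b (F X : Subset k) x → ∣ symDiff (a ∷ F) (x ∷ X) ∣ ≤ suc ∣ symDiff (b ∷ F) (x ∷ X) ∣
∣symDiff-flipˡ∣ a b F X x = ∣∷∣-≤-suc (a xor x) (b xor x) (symDiff F X)

∣symDiff-flipʳ∣ : ∀ {k} a b (F X : Subset k) x → ∣ symDiff (x ∷ F) (a ∷ X) ∣ ≤ suc ∣ symDiff (x ∷ F) (b ∷ X) ∣
∣symDiff-flipʳ∣ a b F X x = ∣∷∣-≤-suc (x xor a) (x xor b) (symDiff F X)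

∣symDiff-update∣ : ∀ {k} (Z ψ : Subset k) u b → ∣ symDiff (Z [ u ]≔ b) ψ ∣ ≤ suc ∣ symDiff Z ψ ∣
∣symDiff-update∣ (z ∷ Z) (p ∷ ψ) zero    b = ∣symDiff-flipˡ∣ b z Z ψ p
∣symDiff-update∣ (z ∷ Z) (p ∷ ψ) (suc u) b with z xor p
... | false = ∣symDiff-update∣ Z ψ u b
... | true  = s≤s (∣symDiff-update∣ Z ψ u b)

∣symDiff-∷ʳ∣ : ∀ {k} (F X : Subset k) a b → ∣ symDiff (F ∷ʳ a) (X ∷ʳ b) ∣ ≡ ∣ symDiff (a ∷ F) (b ∷ X) ∣
∣symDiff-∷ʳ∣ []      []      a b = refl
∣symDiff-∷ʳ∣ (f ∷ F) (x ∷ X) a b with f xor x | a xor b | ∣symDiff-∷ʳ∣ F X a b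
... | false | false | ih = ih
... | false | true  | ih = ih
... | true  | false | ih = cong suc ih
... | true  | true  | ih = cong suc ih

-- Exchange in M_A

-- Evaluate vᵀ A w in two ways: only the term u survives on the left, and every term vanishes
-- on the right once A is transposed.
*ᵥ-removed≡false : ∀ {k} {A : Matrix k} {G v w : Subset k} {u} → Symmetric A →
  v ⊆ G → InKernel A G v → lookup v u ≡ true →
  w ⊆ (G [ u ]≔ false) → InKernel A (G [ u ]≔ false) w → (A *ᵥ w) u ≡ false
*ᵥ-removed≡false {A = A} {G} {v} {w} {u} symA v⊆G kerᵥ vᵤ w⊆Y kerw = begin
  (A *ᵥ w) u                           ≡⟨ cong (_∧ (A *ᵥ w) u) vᵤ ⟨
  lookup v u ∧ (A *ᵥ w) u              ≡⟨ sum-single _ u others ⟨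
  sum (λ i → lookup v i ∧ (A *ᵥ w) i)  ≡⟨ *ᵥ-transpose symA v w ⟩
  sum (λ j → lookup w j ∧ (A *ᵥ v) j)  ≡⟨ sum-∧-InKernel {A = A} {G} {v} {w} kerᵥ (λ j → update-⊆ G u j ∘ w⊆Y j) ⟩
  false                                ∎
  where
  others : ∀ i → i ≢ u → lookup v i ∧ (A *ᵥ w) i ≡ false
  others i i≢u with lookup v i in vᵢ
  ... | false = refl
  ... | true  = kerw i (∈-update G i≢u (v⊆G i vᵢ))

module _ {k} {A : Matrix k} {F : Subset k} {x : Fin k} (nd : Nondeg A F) where

  private
    G : Subset k
    G = F [ x ]≔ false

  *ᵥ-removed≡true : ∀ {v} → v ⊆ G → InKernel A G v → v ≢ ⊥ → (A *ᵥ v) x ≡ true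
  *ᵥ-removed≡true {v} v⊆G kerᵥ v≢⊥ with (A *ᵥ v) x in Avₓ
  ... | true  = refl
  ... | false = ⊥-elim (v≢⊥ (nd v (λ i → update-⊆ F x i ∘ v⊆G i) kerF))
    where
    kerF : InKernel A F v
    kerF i i∈F with i ≟ᶠ x
    ... | yes refl = Avₓ
    ... | no i≢x   = kerᵥ i (∈-update F i≢x i∈F)

  -- w + (A w)ₓ v lies in the kernel of A[F], hence vanishes; at u this forces (A w)ₓ = 0.
  Nondeg-exchange : Symmetric A → ∀ {v u} → v ⊆ G → InKernel A G v → lookup v u ≡ true →
                    Nondeg A (G [ u ]≔ false)
  Nondeg-exchange symA {v} {u} v⊆G kerᵥ vᵤ w w⊆Y kerw = ≡⊥⁺ w w≡false
    where
    α : Bool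
    α = (A *ᵥ w) x

    w′ : Subset k
    w′ = zipWith (λ a b → a xor (α ∧ b)) w v

    lookup-w′ : ∀ i → lookup w′ i ≡ lookup w i xor (α ∧ lookup v i)
    lookup-w′ i = lookup-zipWith _ i w v

    w′⊆F : w′ ⊆ F
    w′⊆F i e with xor-∧-true⁻ (trans (sym (lookup-w′ i)) e)
    ... | inj₁ wᵢ = update-⊆ F x i (update-⊆ G u i (w⊆Y i wᵢ))
    ... | inj₂ vᵢ = update-⊆ F x i (v⊆G i vᵢ)

    Avₓ : (A *ᵥ v) x ≡ true
    Avₓ = *ᵥ-removed≡true {v} v⊆G kerᵥ (lookup-true⇒≢⊥ vᵤ)

    Awᵢ : ∀ i → i ≢ x → lookup F i ≡ true → (A *ᵥ w) i ≡ false
    Awᵢ i i≢x i∈F with i ≟ᶠ u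
    ... | yes refl = *ᵥ-removed≡false {A = A} {G} {v} {w} symA v⊆G kerᵥ vᵤ w⊆Y kerw
    ... | no i≢u   = kerw i (∈-update G i≢u (∈-update F i≢x i∈F))

    kerw′ : InKernel A F w′
    kerw′ i i∈F = trans (*ᵥ-xor-scaled A w v α i) (row i∈F)
      where
      row : lookup F i ≡ true → (A *ᵥ w) i xor (α ∧ (A *ᵥ v) i) ≡ false
      row i∈F with i ≟ᶠ x
      ... | yes refl = begin
        α xor (α ∧ (A *ᵥ v) x)  ≡⟨ cong (λ b → α xor (α ∧ b)) Avₓ ⟩
        α xor (α ∧ true)        ≡⟨ cong (α xor_) (∧-identityʳ α) ⟩
        α xor α                 ≡⟨ xor-same α ⟩
        false                   ∎
      ... | no i≢x = begin
        (A *ᵥ w) i xor (α ∧ (A *ᵥ v) i)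
          ≡⟨ cong₂ (λ a b → a xor (α ∧ b)) (Awᵢ i i≢x i∈F) (kerᵥ i (∈-update F i≢x i∈F)) ⟩
        α ∧ false
          ≡⟨ ∧-zeroʳ α ⟩
        false   ∎

    w′ᵢ : ∀ i → lookup w i xor (α ∧ lookup v i) ≡ false
    w′ᵢ i = trans (sym (lookup-w′ i)) (trans (cong (λ z → lookup z i) (nd w′ w′⊆F kerw′)) (lookup-⊥ i))

    wᵤ : lookup w u ≡ false
    wᵤ = ⊆-false w (G [ u ]≔ false) w⊆Y (lookup∘update u G false)

    α≡false : α ≡ false
    α≡false = begin
      α                                  ≡⟨ ∧-identityʳ α ⟨
      α ∧ true                           ≡⟨ cong (α ∧_) vᵤ ⟨
      α ∧ lookup v u                     ≡⟨ cong (_xor (α ∧ lookup v u)) wᵤ ⟨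
      lookup w u xor (α ∧ lookup v u)    ≡⟨ w′ᵢ u ⟩
      false                              ∎

    w≡false : ∀ i → lookup w i ≡ false
    w≡false i = begin
      lookup w i                         ≡⟨ xor-identityʳ _ ⟨
      lookup w i xor false               ≡⟨ cong (λ a → lookup w i xor (a ∧ lookup v i)) α≡false ⟨
      lookup w i xor (α ∧ lookup v i)    ≡⟨ w′ᵢ i ⟩
      false                              ∎

M-exchange : ∀ {m} {A : Matrix (suc m)} → Symmetric A → ∀ {F} → M A F ≡ true → ∀ ψ →
  ∃[ Y ] M A (false ∷ Y) ≡ true × ∣ symDiff Y ψ ∣ ≤ ∣ symDiff F (false ∷ ψ) ∣
M-exchange symA {false ∷ Z} F∈M ψ = Z , F∈M , ≤-refl
M-exchange {A = A} symA {true ∷ Z} F∈M ψ with M A (false ∷ Z) in G∈M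
... | true  = Z , G∈M , n≤1+n _
... | false with nondegB-false⁻ A (false ∷ Z) G∈M
... | v , v⊆G , kerᵥ , v≢⊥ with ≢⊥⇒∃ v v≢⊥
... | zero  , v₀ = case v⊆G zero v₀ of λ ()
... | suc u , vᵤ =
  Z [ u ]≔ false ,
  from (nondegB⇔ A (false ∷ (Z [ u ]≔ false)))
    (Nondeg-exchange {A = A} {true ∷ Z} {zero} (to (nondegB⇔ A (true ∷ Z)) F∈M) symA {v} {suc u} v⊆G kerᵥ vᵤ) ,
  ∣symDiff-update∣ Z ψ u false

-- The extended matrix A′

lookup-∷ʳ-inject₁ : ∀ {A : Set} {n} (v : Vec A n) b j → lookup (v ∷ʳ b) (inject₁ j) ≡ lookup v j
lookup-∷ʳ-inject₁ (x ∷ v) b zero    = refl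
lookup-∷ʳ-inject₁ (x ∷ v) b (suc j) = lookup-∷ʳ-inject₁ v b j

lookup-∷ʳ-fromℕ : ∀ {A : Set} {n} (v : Vec A n) b → lookup (v ∷ʳ b) (fromℕ n) ≡ b
lookup-∷ʳ-fromℕ []      b = refl
lookup-∷ʳ-fromℕ (x ∷ v) b = lookup-∷ʳ-fromℕ v b

∀-inject₁-fromℕ : ∀ {n} (P : Fin (suc n) → Set) → (∀ j → P (inject₁ j)) → P (fromℕ n) → ∀ i → P i
∀-inject₁-fromℕ {zero}  P _   Pₙ zero    = Pₙ
∀-inject₁-fromℕ {suc n} P Pⱼ  _  zero    = Pⱼ zero
∀-inject₁-fromℕ {suc n} P Pⱼ  Pₙ (suc i) = ∀-inject₁-fromℕ (P ∘ suc) (Pⱼ ∘ suc) Pₙ i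

⊥-∷ʳ : ∀ n → ⊥ {suc n} ≡ ⊥ {n} ∷ʳ false
⊥-∷ʳ zero    = refl
⊥-∷ʳ (suc n) = cong (false ∷_) (⊥-∷ʳ n)

∷ʳ≡⊥⁻ : ∀ {n} (v : Subset n) b → v ∷ʳ b ≡ ⊥ → v ≡ ⊥ × b ≡ false
∷ʳ≡⊥⁻ {n} v b e = ∷ʳ-injective v ⊥ (trans e (⊥-∷ʳ n))

∷ʳ≡⊥⁺ : ∀ {n} {v : Subset n} {b} → v ≡ ⊥ → b ≡ false → v ∷ʳ b ≡ ⊥
∷ʳ≡⊥⁺ {n} refl refl = sym (⊥-∷ʳ n)

module _ {n} (v X : Subset n) (b c : Bool) where

  ⊆-∷ʳ⁺ : v ⊆ X → (b ≡ true → c ≡ true) → (v ∷ʳ b) ⊆ (X ∷ʳ c)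
  ⊆-∷ʳ⁺ v⊆X b⇒c = ∀-inject₁-fromℕ (λ i → lookup (v ∷ʳ b) i ≡ true → lookup (X ∷ʳ c) i ≡ true)
    (λ j e → trans (lookup-∷ʳ-inject₁ X c j) (v⊆X j (trans (sym (lookup-∷ʳ-inject₁ v b j)) e)))
    (λ e → trans (lookup-∷ʳ-fromℕ X c) (b⇒c (trans (sym (lookup-∷ʳ-fromℕ v b)) e)))

  ⊆-∷ʳ⁻ : (v ∷ʳ b) ⊆ (X ∷ʳ c) → v ⊆ X × (b ≡ true → c ≡ true)
  ⊆-∷ʳ⁻ v⊆X =
    (λ j e → trans (sym (lookup-∷ʳ-inject₁ X c j)) (v⊆X (inject₁ j) (trans (lookup-∷ʳ-inject₁ v b j) e))) ,
    (λ e → trans (sym (lookup-∷ʳ-fromℕ X c)) (v⊆X (fromℕ n) (trans (lookup-∷ʳ-fromℕ v b) e)))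

oldIndex-inject₁ : ∀ {n} (j : Fin n) → oldIndex (inject₁ j) ≡ just j
oldIndex-inject₁ {suc n} zero    = refl
oldIndex-inject₁ {suc n} (suc j) = cong (Maybe.map suc) (oldIndex-inject₁ j)

oldIndex-fromℕ : ∀ n → oldIndex (fromℕ n) ≡ nothing
oldIndex-fromℕ zero    = refl
oldIndex-fromℕ (suc n) = cong (Maybe.map suc) (oldIndex-fromℕ n)

module _ {n} (A : Matrix n) where

  extend-*ᵥ-inject₁ : ∀ v b i → (extend A *ᵥ (v ∷ʳ b)) (inject₁ i) ≡ (A *ᵥ v) i xor (isFirst i ∧ b)
  extend-*ᵥ-inject₁ v b i = begin
    sum (λ j → extend A (inject₁ i) j ∧ lookup (v ∷ʳ b) j)
      ≡⟨ sum-init-last (λ j → extend A (inject₁ i) j ∧ lookup (v ∷ʳ b) j) ⟩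
    sum (λ j → extend A (inject₁ i) (inject₁ j) ∧ lookup (v ∷ʳ b) (inject₁ j))
      xor (extend A (inject₁ i) (fromℕ n) ∧ lookup (v ∷ʳ b) (fromℕ n))
      ≡⟨ cong₂ _xor_ (sum-cong-≗ (λ j → cong₂ _∧_ (entry j) (lookup-∷ʳ-inject₁ v b j)))
                     (cong₂ _∧_ corner (lookup-∷ʳ-fromℕ v b)) ⟩
    (A *ᵥ v) i xor (isFirst i ∧ b)
      ∎
    where
    entry : ∀ j → extend A (inject₁ i) (inject₁ j) ≡ A i j
    entry j = cong₂ (extendEntry A) (oldIndex-inject₁ i) (oldIndex-inject₁ j)
    corner : extend A (inject₁ i) (fromℕ n) ≡ isFirst i
    corner = cong₂ (extendEntry A) (oldIndex-inject₁ i) (oldIndex-fromℕ n)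

extend-*ᵥ-fromℕ : ∀ {m} (A : Matrix (suc m)) v b → (extend A *ᵥ (v ∷ʳ b)) (fromℕ (suc m)) ≡ lookup v zero
extend-*ᵥ-fromℕ {m} A v b = begin
  sum (λ j → extend A L j ∧ lookup (v ∷ʳ b) j)
    ≡⟨ sum-init-last (λ j → extend A L j ∧ lookup (v ∷ʳ b) j) ⟩
  sum (λ j → extend A L (inject₁ j) ∧ lookup (v ∷ʳ b) (inject₁ j)) xor (extend A L L ∧ lookup (v ∷ʳ b) L)
    ≡⟨ cong₂ _xor_ (sum-cong-≗ (λ j → cong₂ _∧_ (entry j) (lookup-∷ʳ-inject₁ v b j)))
                   (cong (_∧ lookup (v ∷ʳ b) L) corner) ⟩
  sum (λ j → isFirst j ∧ lookup v j) xor false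
    ≡⟨ xor-identityʳ _ ⟩
  lookup v zero xor sum {m} (λ _ → false)
    ≡⟨ cong (lookup v zero xor_) (sum-zero {m} (λ _ → refl)) ⟩
  lookup v zero xor false
    ≡⟨ xor-identityʳ _ ⟩
  lookup v zero
    ∎
  where
  L : Fin (suc (suc m))
  L = fromℕ (suc m)
  entry : ∀ j → extend A L (inject₁ j) ≡ isFirst j
  entry j = cong₂ (extendEntry A) (oldIndex-fromℕ (suc m)) (oldIndex-inject₁ j)
  corner : extend A L L ≡ false
  corner = cong₂ (extendEntry A) (oldIndex-fromℕ (suc m)) (oldIndex-fromℕ (suc m))

module _ {m} (A : Matrix (suc m)) (X v : Subset (suc m)) (b c : Bool) where

  InKernel-extend⁺ : (∀ i → lookup X i ≡ true → (A *ᵥ v) i xor (isFirst i ∧ b) ≡ false) →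
                     (c ≡ true → lookup v zero ≡ false) → InKernel (extend A) (X ∷ʳ c) (v ∷ʳ b)
  InKernel-extend⁺ rows v₀ = ∀-inject₁-fromℕ (λ i → lookup (X ∷ʳ c) i ≡ true → (extend A *ᵥ (v ∷ʳ b)) i ≡ false)
    (λ j e → trans (extend-*ᵥ-inject₁ A v b j) (rows j (trans (sym (lookup-∷ʳ-inject₁ X c j)) e)))
    (λ e → trans (extend-*ᵥ-fromℕ A v b) (v₀ (trans (sym (lookup-∷ʳ-fromℕ X c)) e)))

  InKernel-extend⁻ : InKernel (extend A) (X ∷ʳ c) (v ∷ʳ b) →
                     (∀ i → lookup X i ≡ true → (A *ᵥ v) i xor (isFirst i ∧ b) ≡ false) ×
                     (c ≡ true → lookup v zero ≡ false)
  InKernel-extend⁻ ker =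
    (λ j e → trans (sym (extend-*ᵥ-inject₁ A v b j)) (ker (inject₁ j) (trans (lookup-∷ʳ-inject₁ X c j) e))) ,
    (λ e → trans (sym (extend-*ᵥ-fromℕ A v b)) (ker (fromℕ (suc m)) (trans (lookup-∷ʳ-fromℕ X c) e)))

module _ {m} (A : Matrix (suc m)) where

  M-extend-∷ʳ-false : ∀ χ → M (extend A) (χ ∷ʳ false) ≡ M A χ
  M-extend-∷ʳ-false χ = M-cong {A = extend A} {A} {χ ∷ʳ false} {χ} (mk⇔ nondeg-A nondeg-A′)
    where
    nondeg-A : Nondeg (extend A) (χ ∷ʳ false) → Nondeg A χ
    nondeg-A nd v v⊆χ kerᵥ = proj₁ (∷ʳ≡⊥⁻ v false (nd (v ∷ʳ false) (⊆-∷ʳ⁺ v χ false false v⊆χ id)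
      (InKernel-extend⁺ A χ v false false (λ i i∈χ → trans (xor-∧-false _ _) (kerᵥ i i∈χ)) λ ())))
    nondeg-A′ : Nondeg A χ → Nondeg (extend A) (χ ∷ʳ false)
    nondeg-A′ nd v′ v′⊆ kerᵥ′ with initLast v′
    ... | v , false , refl = ∷ʳ≡⊥⁺ (nd v (proj₁ (⊆-∷ʳ⁻ v χ false false v′⊆))
            (λ i i∈χ → trans (sym (xor-∧-false _ _)) (proj₁ (InKernel-extend⁻ A χ v false false kerᵥ′) i i∈χ))) refl
    ... | v , true  , refl = case proj₂ (⊆-∷ʳ⁻ v χ true false v′⊆) refl of λ ()

  -- A′ e_{n+1} = e₁, and 1 is outside the set.
  M-extend-false-∷ʳ-true : ∀ ψ → M (extend A) ((false ∷ ψ) ∷ʳ true) ≡ false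
  M-extend-false-∷ʳ-true ψ = M-false {A = extend A} {(false ∷ ψ) ∷ʳ true} λ nd →
    case proj₂ (∷ʳ≡⊥⁻ ⊥ true (nd (⊥ ∷ʳ true) (⊆-∷ʳ⁺ ⊥ (false ∷ ψ) true true ⊆-⊥ id)
                            (InKernel-extend⁺ A (false ∷ ψ) ⊥ true true rows λ _ → refl))) of λ ()
    where
    ⊆-⊥ : ⊥ ⊆ (false ∷ ψ)
    ⊆-⊥ i e = case trans (sym (lookup-⊥ i)) e of λ ()
    rows : ∀ i → lookup (false ∷ ψ) i ≡ true → (A *ᵥ ⊥) i xor (isFirst i ∧ true) ≡ false
    rows (suc i) _ = trans (xor-identityʳ _) (*ᵥ-⊥ A (suc i))

  M-extend-true-∷ʳ-true : ∀ ψ → M (extend A) ((true ∷ ψ) ∷ʳ true) ≡ M A (false ∷ ψ)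
  M-extend-true-∷ʳ-true ψ = M-cong {A = extend A} {A} {(true ∷ ψ) ∷ʳ true} {false ∷ ψ} (mk⇔ nondeg-A nondeg-A′)
    where
    nondeg-A : Nondeg (extend A) ((true ∷ ψ) ∷ʳ true) → Nondeg A (false ∷ ψ)
    nondeg-A nd v v⊆ kerᵥ =
      proj₁ (∷ʳ≡⊥⁻ v b (nd (v ∷ʳ b) (⊆-∷ʳ⁺ v (true ∷ ψ) b true v⊆′ λ _ → refl)
                      (InKernel-extend⁺ A (true ∷ ψ) v b true rows λ _ → ⊆-false v (false ∷ ψ) v⊆ refl)))
      where
      -- The new coordinate b cancels row 1 of A′ (v ∷ʳ b).
      b : Bool
      b = (A *ᵥ v) zero
      v⊆′ : v ⊆ (true ∷ ψ)
      v⊆′ zero    _ = refl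
      v⊆′ (suc i) e = v⊆ (suc i) e
      rows : ∀ i → lookup (true ∷ ψ) i ≡ true → (A *ᵥ v) i xor (isFirst i ∧ b) ≡ false
      rows zero    _   = xor-same b
      rows (suc i) i∈ψ = trans (xor-identityʳ _) (kerᵥ (suc i) i∈ψ)
    nondeg-A′ : Nondeg A (false ∷ ψ) → Nondeg (extend A) ((true ∷ ψ) ∷ʳ true)
    nondeg-A′ nd v′ v′⊆ kerᵥ′ with initLast v′
    ... | v , b , refl = ∷ʳ≡⊥⁺ v≡⊥ b≡false
      where
      rows : ∀ i → lookup (true ∷ ψ) i ≡ true → (A *ᵥ v) i xor (isFirst i ∧ b) ≡ false
      rows = proj₁ (InKernel-extend⁻ A (true ∷ ψ) v b true kerᵥ′)
      v₀ : lookup v zero ≡ false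
      v₀ = proj₂ (InKernel-extend⁻ A (true ∷ ψ) v b true kerᵥ′) refl
      v⊆ : v ⊆ (false ∷ ψ)
      v⊆ zero    e = case trans (sym v₀) e of λ ()
      v⊆ (suc i) e = proj₁ (⊆-∷ʳ⁻ v (true ∷ ψ) b true v′⊆) (suc i) e
      v≡⊥ : v ≡ ⊥
      v≡⊥ = nd v v⊆ λ { (suc i) i∈ψ → trans (sym (xor-identityʳ _)) (rows (suc i) i∈ψ) }
      b≡false : b ≡ false
      b≡false = begin
        b                       ≡⟨ cong (_xor b) (trans (sym (*ᵥ-⊥ A zero)) (cong (λ z → (A *ᵥ z) zero) (sym v≡⊥))) ⟩
        (A *ᵥ v) zero xor b     ≡⟨ rows zero refl ⟩
        false                   ∎

-- Distances and counting subsets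

module _ {k} (D : DeltaMatroid k) (X : Subset k) where

  private
    cheapest : ℕ → List (Subset k) → ℕ
    cheapest = foldr (λ F m → if D F then ∣ symDiff F X ∣ ⊓ m else m)

    cheapest-≤ : ∀ n Fs {F} → F ∈ Fs → D F ≡ true → cheapest n Fs ≤ ∣ symDiff F X ∣
    cheapest-≤ n (F ∷ Fs) (here refl) F∈D rewrite F∈D = m⊓n≤m _ _
    cheapest-≤ n (G ∷ Fs) (there F∈Fs) F∈D with D G
    ... | true  = ≤-trans (m⊓n≤n _ _) (cheapest-≤ n Fs F∈Fs F∈D)
    ... | false = cheapest-≤ n Fs F∈Fs F∈D

    cheapest-attained : ∀ n Fs → cheapest n Fs ≡ n ⊎ ∃[ F ] D F ≡ true × cheapest n Fs ≡ ∣ symDiff F X ∣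
    cheapest-attained n []       = inj₁ refl
    cheapest-attained n (G ∷ Fs) with D G in G∈D
    ... | false = cheapest-attained n Fs
    ... | true with ⊓-sel ∣ symDiff G X ∣ (cheapest n Fs)
    ...   | inj₁ e = inj₂ (G , G∈D , e)
    ...   | inj₂ e rewrite e = cheapest-attained n Fs

  dist-≤ : ∀ {F} → D F ≡ true → dist D X ≤ ∣ symDiff F X ∣
  dist-≤ = cheapest-≤ k (allSubsets k) (∈-allSubsets _)

  -- The starting value k of the fold is only a junk value, returned when no set is feasible.
  dist-attained : ∀ {F₀} → D F₀ ≡ true → ∃[ F ] D F ≡ true × dist D X ≡ ∣ symDiff F X ∣
  dist-attained {F₀} F₀∈D with cheapest-attained k (allSubsets k)
  ... | inj₂ attained = attained
  ... | inj₁ e =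
    F₀ , F₀∈D , ≤-antisym (dist-≤ F₀∈D) (subst (∣ symDiff F₀ X ∣ ≤_) (sym e) (∣p∣≤n (symDiff F₀ X)))

dist-≤-transfer : ∀ {k l} (D : DeltaMatroid k) X (E : DeltaMatroid l) Y c d {F₀} → D F₀ ≡ true →
  (∀ {F} → D F ≡ true → ∃[ G ] E G ≡ true × c + ∣ symDiff G Y ∣ ≤ d + ∣ symDiff F X ∣) →
  c + dist E Y ≤ d + dist D X
dist-≤-transfer D X E Y c d F₀∈D match with dist-attained D X F₀∈D
... | F , F∈D , distF with match F∈D
... | G , G∈E , cost rewrite distF = ≤-trans (+-monoʳ-≤ c (dist-≤ E Y G∈E)) cost

countSubsets : ∀ {k p} {P : Pred (Subset k) p} → Decidable P → ℕ
countSubsets {k} P? = length (filter P? (allSubsets k))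

length-filter-map : ∀ {A B : Set} {p} {P : Pred B p} (P? : Decidable P) (f : A → B) xs →
  length (filter P? (map f xs)) ≡ length (filter (P? ∘ f) xs)
length-filter-map P? f []       = refl
length-filter-map P? f (x ∷ xs) with does (P? (f x))
... | true  = cong suc (length-filter-map P? f xs)
... | false = length-filter-map P? f xs

countSubsets-∷ : ∀ {k p} {P : Pred (Subset (suc k)) p} (P? : Decidable P) →
  countSubsets P? ≡ countSubsets (P? ∘ (false ∷_)) + countSubsets (P? ∘ (true ∷_))
countSubsets-∷ {k} P? =
  trans (cong length (filter-++ P? (map (false ∷_) S) (map (true ∷_) S)))
  (trans (length-++ (filter P? (map (false ∷_) S)))
         (cong₂ _+_ (length-filter-map P? (false ∷_) S) (length-filter-map P? (true ∷_) S)))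
  where
  S : List (Subset k)
  S = allSubsets k

countSubsets-cong : ∀ {k p q} {P : Pred (Subset k) p} {Q : Pred (Subset k) q} (P? : Decidable P) (Q? : Decidable Q) →
  (∀ {φ} → P φ → Q φ) → (∀ {φ} → Q φ → P φ) → countSubsets P? ≡ countSubsets Q?
countSubsets-cong {k} P? Q? P⇒Q Q⇒P = cong length (filter-≐ P? Q? (P⇒Q , Q⇒P) (allSubsets k))

countSubsets-∷ʳ : ∀ {k p} {P : Pred (Subset (suc k)) p} (P? : Decidable P) →
  countSubsets P? ≡ countSubsets (P? ∘ (_∷ʳ false)) + countSubsets (P? ∘ (_∷ʳ true))
countSubsets-∷ʳ {zero}  P? = trans (countSubsets-∷ P?) (cong₂ _+_ (on-[] false) (on-[] true))
  where
  on-[] : ∀ b → countSubsets (P? ∘ (b ∷_)) ≡ countSubsets (P? ∘ (_∷ʳ b))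
  on-[] b = countSubsets-cong (P? ∘ (b ∷_)) (P? ∘ (_∷ʳ b)) (λ { {[]} p → p }) (λ { {[]} p → p })
countSubsets-∷ʳ {suc k} P? = begin
  countSubsets P?
    ≡⟨ countSubsets-∷ P? ⟩
  countSubsets (P? ∘ (false ∷_)) + countSubsets (P? ∘ (true ∷_))
    ≡⟨ cong₂ _+_ (countSubsets-∷ʳ (P? ∘ (false ∷_))) (countSubsets-∷ʳ (P? ∘ (true ∷_))) ⟩
  (count (false ∷_) false + count (false ∷_) true) + (count (true ∷_) false + count (true ∷_) true)
    ≡⟨ interchange (count (false ∷_) false) (count (false ∷_) true) (count (true ∷_) false) (count (true ∷_) true) ⟩
  (count (false ∷_) false + count (true ∷_) false) + (count (false ∷_) true + count (true ∷_) true)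
    ≡⟨ cong₂ _+_ (countSubsets-∷ (P? ∘ (_∷ʳ false))) (countSubsets-∷ (P? ∘ (_∷ʳ true))) ⟨
  countSubsets (P? ∘ (_∷ʳ false)) + countSubsets (P? ∘ (_∷ʳ true))
    ∎
  where
  count : (Subset (suc k) → Subset (suc (suc k))) → Bool → ℕ
  count f b = countSubsets (λ v → P? (f (v ∷ʳ b)))

countSubsets-∅ : ∀ {k p} {P : Pred (Subset k) p} (P? : Decidable P) → (∀ φ → ¬ P φ) → countSubsets P? ≡ 0
countSubsets-∅ {k} P? ¬P = cong length (filter-none P? {xs = allSubsets k} (All.tabulate (λ {φ} _ → ¬P φ)))

fibre : ∀ {k} → (Subset k → ℕ) → ℕ → ℕ
fibre f i = countSubsets (λ φ → f φ ≟ i)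

fibre-cong : ∀ {k} {f g : Subset k → ℕ} → f ≗ g → ∀ i → fibre f i ≡ fibre g i
fibre-cong {f = f} {g} f≗g i = countSubsets-cong (λ φ → f φ ≟ i) (λ φ → g φ ≟ i)
  (λ {φ} → trans (sym (f≗g φ))) (λ {φ} → trans (f≗g φ))

fibre-suc : ∀ {k} (f : Subset k → ℕ) i → fibre (suc ∘ f) (suc i) ≡ fibre f i
fibre-suc f i = countSubsets-cong (λ φ → suc (f φ) ≟ suc i) (λ φ → f φ ≟ i) suc-injective (cong suc)

fibre-suc-zero : ∀ {k} (f : Subset k → ℕ) → fibre (suc ∘ f) zero ≡ 0
fibre-suc-zero f = countSubsets-∅ (λ φ → suc (f φ) ≟ zero) (λ _ ())

-- The recursion

module _ {m} (D : DeltaMatroid (suc m)) (D₁ : DeltaMatroid m) (D′ : DeltaMatroid (suc (suc m)))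
  (D-⊥ : D ⊥ ≡ true)
  (D₁-def : ∀ Y → D₁ Y ≡ D (false ∷ Y))
  (D′-∷ʳ-false : ∀ F → D′ (F ∷ʳ false) ≡ D F)
  (D′-false-∷ʳ-true : ∀ Y → D′ ((false ∷ Y) ∷ʳ true) ≡ false)
  (D′-true-∷ʳ-true : ∀ Y → D′ ((true ∷ Y) ∷ʳ true) ≡ D (false ∷ Y))
  (exchange : ∀ {F} → D F ≡ true → ∀ ψ →
              ∃[ Y ] D (false ∷ Y) ≡ true × ∣ symDiff Y ψ ∣ ≤ ∣ symDiff F (false ∷ ψ) ∣)
  where

  private
    data Feasible′ : Subset (suc (suc m)) → Set where
      old : ∀ {F} → D F ≡ true → Feasible′ (F ∷ʳ false)
      new : ∀ {Y} → D₁ Y ≡ true → Feasible′ ((true ∷ Y) ∷ʳ true)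

    feasible′ : ∀ {G} → D′ G ≡ true → Feasible′ G
    feasible′ {G} G∈D′ with initLast G
    ... | F , false , refl = old (trans (sym (D′-∷ʳ-false F)) G∈D′)
    ... | false ∷ Y , true , refl = case trans (sym (D′-false-∷ʳ-true Y)) G∈D′ of λ ()
    ... | true  ∷ Y , true , refl = new (trans (D₁-def Y) (trans (sym (D′-true-∷ʳ-true Y)) G∈D′))

    D′-⊥ : D′ ⊥ ≡ true
    D′-⊥ = trans (cong D′ (⊥-∷ʳ (suc m))) (trans (D′-∷ʳ-false ⊥) D-⊥)

    exchange₁ : ∀ {F} → D F ≡ true → ∀ ψ →
                ∃[ Y ] D₁ Y ≡ true × ∣ symDiff Y ψ ∣ ≤ ∣ symDiff F (false ∷ ψ) ∣
    exchange₁ F∈D ψ with exchange F∈D ψ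
    ... | Y , Y∈ , cost = Y , trans (D₁-def Y) Y∈ , cost

    D₁-inhabited : ∃[ Y ] D₁ Y ≡ true
    D₁-inhabited with exchange₁ D-⊥ ⊥
    ... | Y , Y∈D₁ , _ = Y , Y∈D₁

    new∈D′ : ∀ {Y} → D₁ Y ≡ true → D′ ((true ∷ Y) ∷ʳ true) ≡ true
    new∈D′ {Y} Y∈D₁ = trans (D′-true-∷ʳ-true Y) (trans (sym (D₁-def Y)) Y∈D₁)

    rotate : ∀ {k} (F X : Subset k) a b → ∣ symDiff (a ∷ F) (b ∷ X) ∣ ≤ ∣ symDiff (F ∷ʳ a) (X ∷ʳ b) ∣
    rotate F X a b = ≤-reflexive (sym (∣symDiff-∷ʳ∣ F X a b))

    rotate⁻ : ∀ {k} (F X : Subset k) a b → ∣ symDiff (F ∷ʳ a) (X ∷ʳ b) ∣ ≤ ∣ symDiff (a ∷ F) (b ∷ X) ∣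
    rotate⁻ F X a b = ≤-reflexive (∣symDiff-∷ʳ∣ F X a b)

  dist-∷ʳ-false : ∀ χ → dist D′ (χ ∷ʳ false) ≡ dist D χ
  dist-∷ʳ-false χ@(x ∷ χ₀) =
    ≤-antisym (dist-≤-transfer D χ D′ X′ 0 0 D-⊥ up) (dist-≤-transfer D′ X′ D χ 0 0 D′-⊥ (down ∘ feasible′))
    where
    X′ : Subset (suc (suc m))
    X′ = χ ∷ʳ false
    up : ∀ {F} → D F ≡ true → ∃[ G ] D′ G ≡ true × ∣ symDiff G X′ ∣ ≤ ∣ symDiff F χ ∣
    up {F} F∈D = F ∷ʳ false , trans (D′-∷ʳ-false F) F∈D , rotate⁻ F χ false false
    down : ∀ {G} → Feasible′ G → ∃[ F ] D F ≡ true × ∣ symDiff F χ ∣ ≤ ∣ symDiff G X′ ∣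
    down (old {F} F∈D)  = F , F∈D , rotate F χ false false
    down (new {Y} Y∈D₁) = false ∷ Y , trans (sym (D₁-def Y)) Y∈D₁ ,
      ≤-trans (∣symDiff-flipˡ∣ false true Y χ₀ x) (rotate (true ∷ Y) χ true false)

  dist-false-∷ʳ-true : ∀ ψ → dist D′ ((false ∷ ψ) ∷ʳ true) ≡ suc (dist D₁ ψ)
  dist-false-∷ʳ-true ψ = ≤-antisym
    (dist-≤-transfer D₁ ψ D′ X′ 0 1 (proj₂ D₁-inhabited) up)
    (dist-≤-transfer D′ X′ D₁ ψ 1 0 D′-⊥ (down ∘ feasible′))
    where
    X′ : Subset (suc (suc m))
    X′ = (false ∷ ψ) ∷ʳ true
    up : ∀ {Y} → D₁ Y ≡ true → ∃[ G ] D′ G ≡ true × ∣ symDiff G X′ ∣ ≤ suc ∣ symDiff Y ψ ∣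
    up {Y} Y∈D₁ = (true ∷ Y) ∷ʳ true , new∈D′ Y∈D₁ , rotate⁻ (true ∷ Y) (false ∷ ψ) true true
    down : ∀ {G} → Feasible′ G → ∃[ Y ] D₁ Y ≡ true × suc ∣ symDiff Y ψ ∣ ≤ ∣ symDiff G X′ ∣
    down (old {F} F∈D) with exchange₁ F∈D ψ
    ... | Y , Y∈D₁ , cost = Y , Y∈D₁ , ≤-trans (s≤s cost) (rotate F (false ∷ ψ) false true)
    down (new {Y} Y∈D₁) = Y , Y∈D₁ , rotate (true ∷ Y) (false ∷ ψ) true true

  dist-true-∷ʳ-true : ∀ ψ → dist D′ ((true ∷ ψ) ∷ʳ true) ≡ dist D₁ ψ
  dist-true-∷ʳ-true ψ = ≤-antisym
    (dist-≤-transfer D₁ ψ D′ X′ 0 0 (proj₂ D₁-inhabited) up)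
    (dist-≤-transfer D′ X′ D₁ ψ 0 0 D′-⊥ (down ∘ feasible′))
    where
    X′ : Subset (suc (suc m))
    X′ = (true ∷ ψ) ∷ʳ true
    up : ∀ {Y} → D₁ Y ≡ true → ∃[ G ] D′ G ≡ true × ∣ symDiff G X′ ∣ ≤ ∣ symDiff Y ψ ∣
    up {Y} Y∈D₁ = (true ∷ Y) ∷ʳ true , new∈D′ Y∈D₁ , rotate⁻ (true ∷ Y) (true ∷ ψ) true true
    down : ∀ {G} → Feasible′ G → ∃[ Y ] D₁ Y ≡ true × ∣ symDiff Y ψ ∣ ≤ ∣ symDiff G X′ ∣
    down (old {f ∷ F} F∈D) with exchange₁ F∈D ψ
    ... | Y , Y∈D₁ , cost = Y , Y∈D₁ ,
      ≤-trans cost (≤-trans (∣symDiff-flipʳ∣ false true F ψ f) (rotate (f ∷ F) (true ∷ ψ) false true))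
    down (new {Y} Y∈D₁) = Y , Y∈D₁ , rotate (true ∷ Y) (true ∷ ψ) true true

  qΔ-extension : ∀ i → qΔ D′ i ≡ (qΔ D +ₚ (x+1* qΔ D₁)) i
  qΔ-extension i = begin
    qΔ D′ i
      ≡⟨ countSubsets-∷ʳ (λ φ → dist D′ φ ≟ i) ⟩
    fibre (dist D′ ∘ (_∷ʳ false)) i + fibre (dist D′ ∘ (_∷ʳ true)) i
      ≡⟨ cong₂ _+_ (fibre-cong dist-∷ʳ-false i) (countSubsets-∷ (λ φ → dist D′ (φ ∷ʳ true) ≟ i)) ⟩
    qΔ D i + (fibre (dist D′ ∘ (_∷ʳ true) ∘ (false ∷_)) i + fibre (dist D′ ∘ (_∷ʳ true) ∘ (true ∷_)) i)
      ≡⟨ cong (qΔ D i +_) (cong₂ _+_ (fibre-cong dist-false-∷ʳ-true i) (fibre-cong dist-true-∷ʳ-true i)) ⟩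
    qΔ D i + (fibre (suc ∘ dist D₁) i + qΔ D₁ i)
      ≡⟨ cong (qΔ D i +_) (shift i) ⟩
    qΔ D i + (x+1* qΔ D₁) i
      ∎
    where
    shift : ∀ i → fibre (suc ∘ dist D₁) i + qΔ D₁ i ≡ (x+1* qΔ D₁) i
    shift zero    = cong (_+ qΔ D₁ zero) (fibre-suc-zero (dist D₁))
    shift (suc j) = trans (cong (_+ qΔ D₁ (suc j)) (fibre-suc (dist D₁) j)) (+-comm (qΔ D₁ j) _)

isColoop₁-M : ∀ {m} (A : Matrix (suc m)) → isColoop₁ (M A) ≡ false
isColoop₁-M A with isColoop₁ (M A) in coloop
... | false = refl
... | true  = case ⇒b-true⁻ (allSubsets⁻ {p = λ F → M A F ⇒b lookup F zero} coloop ⊥) (M-⊥ A) of λ ()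

delete₁-M : ∀ {m} (A : Matrix (suc m)) Y → delete₁ (M A) Y ≡ M A (false ∷ Y)
delete₁-M A Y = cong (if_then M A (true ∷ Y) else M A (false ∷ Y)) (isColoop₁-M A)

lemma1 : (m : ℕ) (A : Matrix (suc m)) → Symmetric A →
    ∀ (i : ℕ) → qΔ (M (extend A)) i ≡ (qΔ (M A) +ₚ (x+1* qΔ (delete₁ (M A)))) i
lemma1 m A symA = qΔ-extension (M A) (delete₁ (M A)) (M (extend A))
  (M-⊥ A) (delete₁-M A)
  (M-extend-∷ʳ-false A) (M-extend-false-∷ʳ-true A) (M-extend-true-∷ʳ-true A)
  (λ {F} → M-exchange {A = A} symA {F})
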